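{- Let $k,\ell\geq 1$ be integers and let $H$ be a graph that is a minor of the $k\times\ell$ grid. Let $J$ be the $2k\times 2\ell$ grid. Then there is an $H$-model $(B_u:u\in V(H))$ in $J$, together with, for each edge $uv\in E(H)$, a chosen edge $e_{uv}$ of $J$ between $B_u$ and $B_v$ (representing $uv$), such that for each vertex $u\in V(H)$ there is a vertex $h_u\in V(B_u)$ that is incident to none of the chosen edges $e_{vw}$, $vw\in E(H)$.
   Context: All graphs are finite, simple and undirected. A graph $H$ is a minor of $G$ if a graph isomorphic to $H$ can be obtained from a subgraph of $G$ by contracting edges. An $H$-model in $G$ is a collection $(B_u:u\in V(H))$ of pairwise disjoint connected subgraphs of $G$ such that for each edge $uv\in E(H)$ there is an edge of $G$ between $B_u$ and $B_v$; such an edge is said to represent $uv$. The $n\times m$ grid is the graph with vertex set $\{1,\dots,n\}\times\{1,\dots,m\}$ where $(x_1,y_1)$ and $(x_2,y_2)$ are adjacent iff $|x_1-x_2|+|y_1-y_2|=1$. -}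

module Defs where

open import Level using (0ℓ)
open import Data.Nat using (ℕ; _*_; _≤_; ∣_-_∣; _+_)
open import Data.Fin using (Fin; toℕ; _<_)
open import Data.Bool using (Bool; T)
open import Data.Product using (Σ; ∃; _×_; _,_)
open import Relation.Nullary using (¬_)
open import Relation.Binary.PropositionalEquality using (_≡_)

record SimpleGraph : Set where
  field
    n     : ℕ
    adj   : Fin n → Fin n → Bool
    sym   : ∀ u v → T (adj u v) → T (adj v u)
    irrefl : ∀ u → ¬ T (adj u u)
  Edge : Fin n → Fin n → Set
  Edge u v = T (adj u v)

record Graph : Set₁ where
  field
    V : Set
    E : V → V → Set

Grid : ℕ → ℕ → Graph
Grid a b = record
  { V = Fin a × Fin b
  ; E = λ { (x₁ , y₁) (x₂ , y₂) →
          ∣ toℕ x₁ - toℕ x₂ ∣ + ∣ toℕ y₁ - toℕ y₂ ∣ ≡ 1 } }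

module _ (G : Graph) where
  open Graph G

  data WalkIn (P : V → Set) : V → V → Set where
    here : ∀ {x} → P x → WalkIn P x x
    step : ∀ {x y z} → P x → E x y → WalkIn P y z → WalkIn P x z

  Connected : (V → Set) → Set
  Connected P = (Σ V P) × (∀ x y → P x → P y → WalkIn P x y)

module _ (H : SimpleGraph) (G : Graph) where
  open SimpleGraph H
  open Graph G

  record Model : Set₁ where
    field
      B        : Fin n → V → Set
      disjoint : ∀ u v x → B u x → B v x → u ≡ v
      conn     : ∀ u → Connected G (B u)
      rep      : ∀ u v → Edge u v → Σ V λ a → Σ V λ b → B u a × B v b × E a b

  record RepEdge (M : Model) (u v : Fin n) : Set where
    field
      a   : V
      b   : V
      a∈  : Model.B M u a
      b∈  : Model.B M v b
      ab  : E a b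

  IsMinor : Set₁
  IsMinor = Model

{-# OPTIONS --safe #-}
-- Halving both coordinates maps J onto the k × ℓ grid, and every fibre is a 2 × 2 block
-- {2x, 2x+1} × {2y, 2y+1}, which is connected; so the preimages of the branch sets of an
-- H-model in the small grid form an H-model in J.  An edge ab of the small grid is
-- represented by the edge joining the corners of the blocks of a and b that face each
-- other.  Since a and b agree in one coordinate, such a corner is even in that coordinate,
-- so the corner (2x+1, 2y+1) of every block lies on no representing edge.
module Submission where

open import Defs
open import Data.Nat using (ℕ; _*_; _≤_)
open import Data.Fin using (Fin; _<_)
open import Data.Product using (Σ; _×_)
open import Relation.Nullary using (¬_)
open import Relation.Binary.PropositionalEquality using (_≡_)

open import Function using (_∘_; _$_)
open import Data.Bool using (if_then_else_)
open import Data.Nat using (zero; suc; _+_; ∣_-_∣)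
open import Data.Nat.Properties
  using (≤-reflexive; *-comm; *-suc; +-comm; +-assoc; +-identityʳ;
         ∣-∣-comm; ∣n-n∣≡0; ∣m-n∣≡0⇒m≡n; ∣m-m+n∣≡n)
open import Data.Fin using (toℕ; cast; combine; remQuot)
open import Data.Fin.Patterns using (0F; 1F)
open import Data.Fin.Properties
  using (toℕ-injective; toℕ-cast; cast-involutive; toℕ-combine; remQuot-combine; combine-remQuot;
         _<?_; <-irrefl; <-asym)
open import Data.Product using (_,_; proj₁; proj₂; uncurry)
open import Data.Sum as Sum using (_⊎_; inj₁; inj₂)
open import Relation.Nullary using (does)
open import Relation.Nullary.Decidable using (dec-true; dec-false)
open import Relation.Binary.PropositionalEquality
  using (_≢_; refl; sym; trans; cong; cong₂; subst; subst₂; module ≡-Reasoning)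

open Graph

module _ {G : Graph} where

  _++ʷ_ : ∀ {P x y z} → WalkIn G P x y → WalkIn G P y z → WalkIn G P x z
  here _       ++ʷ w = w
  step px e v ++ʷ w = step px e (v ++ʷ w)

  WalkIn-map : ∀ {P Q : V G → Set} {x y} → (∀ {z} → P z → Q z) → WalkIn G P x y → WalkIn G Q x y
  WalkIn-map f (here px)     = here (f px)
  WalkIn-map f (step px e w) = step (f px) e (WalkIn-map f w)

  ≡-or-edge⇒walk : ∀ {P x y} → P x → P y → x ≡ y ⊎ E G x y → WalkIn G P x y
  ≡-or-edge⇒walk px _  (inj₁ refl) = here px
  ≡-or-edge⇒walk px py (inj₂ e)    = step px e (here py)

representing-edge : ∀ {H G} (M : Model H G) {u v} → SimpleGraph.Edge H u v → RepEdge H G M u v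
representing-edge M {u} {v} q =
  let (a , b , a∈ , b∈ , ab) = Model.rep M u v q
  in record { a = a ; b = b ; a∈ = a∈ ; b∈ = b∈ ; ab = ab }

-- The fibres of π are the branch sets of a G-model in J covering all of V J.
record Contraction (J G : Graph) : Set where
  field
    π               : V J → V G
    fibre-connected : ∀ c → Connected J (λ z → π z ≡ c)
    lift            : V G → V G → V J
    π-lift          : ∀ a b → π (lift a b) ≡ a
    lift-edge       : ∀ {a b} → E G a b → E J (lift a b) (lift b a)

module _ {J G : Graph} (C : Contraction J G) where
  open Contraction C

  walk-in-fibre : ∀ {P a p q} → P a → π p ≡ a → π q ≡ a → WalkIn J (P ∘ π) p q
  walk-in-fibre {P} {a} Pa πp πq =
    WalkIn-map (λ πz → subst P (sym πz) Pa) (proj₂ (fibre-connected a) _ _ πp πq)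

  walk-lift : ∀ {P a b} → WalkIn G P a b → ∀ {p q} → π p ≡ a → π q ≡ b → WalkIn J (P ∘ π) p q
  walk-lift (here Pa) πp πq = walk-in-fibre Pa πp πq
  walk-lift {P} (step {a} {a′} Pa e w) πp πq =
    walk-in-fibre Pa πp (π-lift a a′)
      ++ʷ step (subst P (sym (π-lift a a′)) Pa) (lift-edge e) (walk-lift w (π-lift a′ a) πq)

  preimage-connected : ∀ {P} → Connected G P → Connected J (P ∘ π)
  preimage-connected {P} ((c , Pc) , walk) =
    let (z , πz) = proj₁ (fibre-connected c)
    in (z , subst P (sym πz) Pc) , λ p q Pp Pq → walk-lift (walk (π p) (π q) Pp Pq) refl refl

  pullback : ∀ {H} → Model H G → Model H J
  pullback M = record
    { B        = λ u → B u ∘ π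
    ; disjoint = λ u v z → disjoint u v (π z)
    ; conn     = λ u → preimage-connected (conn u)
    ; rep      = λ u v q →
        let (a , b , a∈ , b∈ , ab) = rep u v q
        in lift a b , lift b a ,
           subst (B u) (sym (π-lift a b)) a∈ , subst (B v) (sym (π-lift b a)) b∈ , lift-edge ab
    }
    where open Model M

  record Holes : Set where
    field
      hole        : V G → V J
      π-hole      : ∀ c → π (hole c) ≡ c
      hole-avoids : ∀ c {a b} → E G a b → hole c ≢ lift a b

ModelWithHoles : SimpleGraph → Graph → Set₁
ModelWithHoles H J =
  Σ (Model H J) λ M →
  Σ ((v w : Fin n) → v < w → Edge v w → RepEdge H J M v w) λ e →
  (u : Fin n) → Σ (V J) λ h → Model.B M u h ×
    ((v w : Fin n) (p : v < w) (q : Edge v w) →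
      ¬ (h ≡ RepEdge.a (e v w p q)) × ¬ (h ≡ RepEdge.b (e v w p q)))
  where open SimpleGraph H

pullback-with-holes : ∀ {J G} → (∀ {a b} → E G a b → E G b a) →
  (C : Contraction J G) → Holes C → ∀ {H} → Model H G → ModelWithHoles H J
pullback-with-holes G-sym C holes M =
  pullback C M , (λ v w _ → representing-edge (pullback C M)) , λ u →
    let (c , c∈) = proj₁ (Model.conn M u)
        edge-of = λ v w q → proj₂ (proj₂ (proj₂ (proj₂ (Model.rep M v w q))))
    in hole c , subst (Model.B M u) (sym (π-hole c)) c∈ ,
       λ v w _ q → hole-avoids c (edge-of v w q) , hole-avoids c (G-sym (edge-of v w q))
  where open Holes holes

Grid-sym : ∀ {a b} {x y : V (Grid a b)} → E (Grid a b) x y → E (Grid a b) y x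
Grid-sym {x = x₁ , y₁} {x₂ , y₂} =
  subst₂ (λ dx dy → dx + dy ≡ 1) (∣-∣-comm (toℕ x₁) (toℕ x₂)) (∣-∣-comm (toℕ y₁) (toℕ y₂))

m+n≡1⇒m≡0∧n≡1∨m≡1∧n≡0 : ∀ m n → m + n ≡ 1 → (m ≡ 0 × n ≡ 1) ⊎ (m ≡ 1 × n ≡ 0)
m+n≡1⇒m≡0∧n≡1∨m≡1∧n≡0 zero          n       eq = inj₁ (refl , eq)
m+n≡1⇒m≡0∧n≡1∨m≡1∧n≡0 (suc zero)    zero    _  = inj₂ (refl , refl)
m+n≡1⇒m≡0∧n≡1∨m≡1∧n≡0 (suc zero)    (suc n) ()
m+n≡1⇒m≡0∧n≡1∨m≡1∧n≡0 (suc (suc m)) n       ()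

∣m-n∣≡1⇒n≡1+m∨m≡1+n : ∀ m n → ∣ m - n ∣ ≡ 1 → n ≡ suc m ⊎ m ≡ suc n
∣m-n∣≡1⇒n≡1+m∨m≡1+n zero          (suc zero) _  = inj₁ refl
∣m-n∣≡1⇒n≡1+m∨m≡1+n (suc zero)    zero       _  = inj₂ refl
∣m-n∣≡1⇒n≡1+m∨m≡1+n (suc m)       (suc n)    eq =
  Sum.map (cong suc) (cong suc) (∣m-n∣≡1⇒n≡1+m∨m≡1+n m n eq)
∣m-n∣≡1⇒n≡1+m∨m≡1+n zero          zero       ()
∣m-n∣≡1⇒n≡1+m∨m≡1+n zero          (suc (suc n)) ()
∣m-n∣≡1⇒n≡1+m∨m≡1+n (suc (suc m)) zero       ()

2[1+n]+0≡2n+1+1 : ∀ n → 2 * suc n + 0 ≡ 2 * n + 1 + 1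
2[1+n]+0≡2n+1+1 n = begin
  2 * suc n + 0   ≡⟨ +-identityʳ (2 * suc n) ⟩
  2 * suc n       ≡⟨ *-suc 2 n ⟩
  2 + 2 * n       ≡⟨ +-comm 2 (2 * n) ⟩
  2 * n + 2       ≡⟨ +-assoc (2 * n) 1 1 ⟨
  2 * n + 1 + 1   ∎
  where open ≡-Reasoning

record Adjacent {n} (i j : Fin n) : Set where
  constructor adjacent
  field ∣i-j∣≡1 : ∣ toℕ i - toℕ j ∣ ≡ 1

Adjacent-sym : ∀ {n} {i j : Fin n} → Adjacent i j → Adjacent j i
Adjacent-sym {i = i} {j} (adjacent d) = adjacent (trans (∣-∣-comm (toℕ j) (toℕ i)) d)

module _ {a b : ℕ} {x₁ x₂ : Fin a} {y₁ y₂ : Fin b} where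

  Grid-edge⇒ : E (Grid a b) (x₁ , y₁) (x₂ , y₂) → (x₁ ≡ x₂ × Adjacent y₁ y₂) ⊎ (Adjacent x₁ x₂ × y₁ ≡ y₂)
  Grid-edge⇒ e with m+n≡1⇒m≡0∧n≡1∨m≡1∧n≡0 _ _ e
  ... | inj₁ (dx , dy) = inj₁ (toℕ-injective (∣m-n∣≡0⇒m≡n dx) , adjacent dy)
  ... | inj₂ (dx , dy) = inj₂ (adjacent dx , toℕ-injective (∣m-n∣≡0⇒m≡n dy))

  Grid-edge⇐ : (x₁ ≡ x₂ × Adjacent y₁ y₂) ⊎ (Adjacent x₁ x₂ × y₁ ≡ y₂) → E (Grid a b) (x₁ , y₁) (x₂ , y₂)
  Grid-edge⇐ (inj₁ (refl , adjacent dy)) rewrite ∣n-n∣≡0 (toℕ x₁) = dy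
  Grid-edge⇐ (inj₂ (adjacent dx , refl)) rewrite ∣n-n∣≡0 (toℕ y₁) = trans (+-identityʳ _) dx

module _ {k : ℕ} where

  join : Fin k → Fin 2 → Fin (2 * k)
  join x d = cast (*-comm k 2) (combine x d)

  split : Fin (2 * k) → Fin k × Fin 2
  split i = remQuot 2 (cast (*-comm 2 k) i)

  split-join : ∀ x d → split (join x d) ≡ (x , d)
  split-join x d =
    trans (cong (remQuot 2) (cast-involutive (*-comm 2 k) (*-comm k 2) (combine x d)))
          (remQuot-combine x d)

  join-split : ∀ i → uncurry join (split i) ≡ i
  join-split i =
    trans (cong (cast (*-comm k 2)) (combine-remQuot {k} 2 (cast (*-comm 2 k) i)))
          (cast-involutive (*-comm k 2) (*-comm 2 k) i)

  toℕ-join : ∀ x d → toℕ (join x d) ≡ 2 * toℕ x + toℕ d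
  toℕ-join x d = trans (toℕ-cast (*-comm k 2) (combine x d)) (toℕ-combine x d)

  join-injectiveʳ : ∀ {x y d e} → join x d ≡ join y e → d ≡ e
  join-injectiveʳ {x} {y} {d} {e} eq =
    trans (cong proj₂ (sym (split-join x d)))
          (trans (cong (proj₂ ∘ split) eq) (cong proj₂ (split-join y e)))

  half : Fin (2 * k) → Fin k
  half = proj₁ ∘ split

  half-join : ∀ x d → half (join x d) ≡ x
  half-join x d = cong proj₁ (split-join x d)

  join-adjacent : ∀ x → Adjacent (join x 0F) (join x 1F)
  join-adjacent x = adjacent $ begin
    ∣ toℕ (join x 0F) - toℕ (join x 1F) ∣ ≡⟨ cong₂ ∣_-_∣ (toℕ-join x 0F) (toℕ-join x 1F) ⟩
    ∣ 2 * toℕ x + 0 - 2 * toℕ x + 1 ∣     ≡⟨ cong (λ m → ∣ m - 2 * toℕ x + 1 ∣) (+-identityʳ (2 * toℕ x)) ⟩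
    ∣ 2 * toℕ x - 2 * toℕ x + 1 ∣         ≡⟨ ∣m-m+n∣≡n (2 * toℕ x) 1 ⟩
    1                                     ∎
    where open ≡-Reasoning

  join-close : ∀ x d d′ → join x d ≡ join x d′ ⊎ Adjacent (join x d) (join x d′)
  join-close x 0F 0F = inj₁ refl
  join-close x 0F 1F = inj₂ (join-adjacent x)
  join-close x 1F 0F = inj₂ (Adjacent-sym (join-adjacent x))
  join-close x 1F 1F = inj₁ refl

  toward : Fin k → Fin k → Fin (2 * k)
  toward a b = join a (if does (a <? b) then 1F else 0F)

  half-toward : ∀ a b → half (toward a b) ≡ a
  half-toward a b = half-join a _

  toward-self : ∀ a → toward a a ≡ join a 0F
  toward-self a rewrite dec-false (a <? a) (<-irrefl refl) = refl

  join-1≢toward-self : ∀ x a → join x 1F ≢ toward a a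
  join-1≢toward-self x a eq with join-injectiveʳ {x = x} {a} (trans eq (toward-self a))
  ... | ()

  toward-successor : ∀ {a b} → toℕ b ≡ suc (toℕ a) → Adjacent (toward a b) (toward b a)
  toward-successor {a} {b} b≡1+a
    rewrite dec-true (a <? b) (≤-reflexive (sym b≡1+a))
          | dec-false (b <? a) (<-asym (≤-reflexive (sym b≡1+a))) = adjacent $ begin
      ∣ toℕ (join a 1F) - toℕ (join b 0F) ∣   ≡⟨ cong₂ ∣_-_∣ (toℕ-join a 1F) (toℕ-join b 0F) ⟩
      ∣ 2 * toℕ a + 1 - 2 * toℕ b + 0 ∣       ≡⟨ cong (λ m → ∣ 2 * toℕ a + 1 - 2 * m + 0 ∣) b≡1+a ⟩
      ∣ 2 * toℕ a + 1 - 2 * suc (toℕ a) + 0 ∣ ≡⟨ cong (∣ 2 * toℕ a + 1 -_∣) (2[1+n]+0≡2n+1+1 (toℕ a)) ⟩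
      ∣ 2 * toℕ a + 1 - 2 * toℕ a + 1 + 1 ∣   ≡⟨ ∣m-m+n∣≡n (2 * toℕ a + 1) 1 ⟩
      1                                       ∎
    where open ≡-Reasoning

  toward-adjacent : ∀ {a b} → Adjacent a b → Adjacent (toward a b) (toward b a)
  toward-adjacent {a} {b} (adjacent adj) with ∣m-n∣≡1⇒n≡1+m∨m≡1+n (toℕ a) (toℕ b) adj
  ... | inj₁ b≡1+a = toward-successor b≡1+a
  ... | inj₂ a≡1+b = Adjacent-sym (toward-successor a≡1+b)

module _ {k ℓ : ℕ} where
  private
    Coarse = Grid k ℓ
    Fine   = Grid (2 * k) (2 * ℓ)

  halve : V Fine → V Coarse
  halve (i , j) = half {k} i , half {ℓ} j

  offset : V Fine → Fin 2 × Fin 2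
  offset (i , j) = proj₂ (split {k} i) , proj₂ (split {ℓ} j)

  corner : V Coarse → Fin 2 × Fin 2 → V Fine
  corner (x , y) (d , e) = join x d , join y e

  halve-corner : ∀ c o → halve (corner c o) ≡ c
  halve-corner (x , y) (d , e) = cong₂ _,_ (half-join x d) (half-join y e)

  corner-halve : ∀ z → corner (halve z) (offset z) ≡ z
  corner-halve (i , j) = cong₂ _,_ (join-split {k} i) (join-split {ℓ} j)

  corner-walk : ∀ c o o′ → WalkIn Fine (λ z → halve z ≡ c) (corner c o) (corner c o′)
  corner-walk c@(x , y) (d , e) (d′ , e′) =
    ≡-or-edge⇒walk (halve-corner c _) (halve-corner c _) horizontal
      ++ʷ ≡-or-edge⇒walk (halve-corner c _) (halve-corner c _) vertical
    where
    horizontal : corner c (d , e) ≡ corner c (d′ , e) ⊎ E Fine (corner c (d , e)) (corner c (d′ , e))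
    horizontal = Sum.map (cong (_, join y e)) (λ dx → Grid-edge⇐ {y₁ = join y e} (inj₂ (dx , refl)))
                   (join-close x d d′)
    vertical : corner c (d′ , e) ≡ corner c (d′ , e′) ⊎ E Fine (corner c (d′ , e)) (corner c (d′ , e′))
    vertical = Sum.map (cong (join x d′ ,_)) (λ dy → Grid-edge⇐ {x₁ = join x d′} (inj₁ (refl , dy)))
                 (join-close y e e′)

  fibre-walk : ∀ {c} z z′ → halve z ≡ c → halve z′ ≡ c → WalkIn Fine (λ w → halve w ≡ c) z z′
  fibre-walk z z′ refl hz′ =
    subst₂ (WalkIn Fine _)
      (corner-halve z) (trans (cong (λ c → corner c (offset z′)) (sym hz′)) (corner-halve z′))
      (corner-walk (halve z) (offset z) (offset z′))

  facing : V Coarse → V Coarse → V Fine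
  facing (a₁ , a₂) (b₁ , b₂) = toward a₁ b₁ , toward a₂ b₂

  facing-edge : ∀ {a b} → E Coarse a b → E Fine (facing a b) (facing b a)
  facing-edge {a₁ , a₂} {b₁ , b₂} e with Grid-edge⇒ {x₁ = a₁} {b₁} {a₂} {b₂} e
  ... | inj₁ (refl , adj) = Grid-edge⇐ {x₁ = toward a₁ a₁} (inj₁ (refl , toward-adjacent adj))
  ... | inj₂ (adj , refl) = Grid-edge⇐ {y₁ = toward a₂ a₂} (inj₂ (toward-adjacent adj , refl))

  odd-corner≢facing : ∀ c {a b} → E Coarse a b → corner c (1F , 1F) ≢ facing a b
  odd-corner≢facing (x , y) {a₁ , a₂} {b₁ , b₂} e eq with Grid-edge⇒ {x₁ = a₁} {b₁} {a₂} {b₂} e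
  ... | inj₁ (refl , _) = join-1≢toward-self x a₁ (cong proj₁ eq)
  ... | inj₂ (_ , refl) = join-1≢toward-self y a₂ (cong proj₂ eq)

  halving : Contraction Fine Coarse
  halving = record
    { π               = halve
    ; fibre-connected = λ c → (corner c (0F , 0F) , halve-corner c (0F , 0F)) , fibre-walk
    ; lift            = facing
    ; π-lift          = λ (a₁ , a₂) (b₁ , b₂) → cong₂ _,_ (half-toward a₁ b₁) (half-toward a₂ b₂)
    ; lift-edge       = facing-edge
    }

  odd-corners : Holes halving
  odd-corners = record
    { hole        = λ c → corner c (1F , 1F)
    ; π-hole      = λ c → halve-corner c (1F , 1F)
    ; hole-avoids = odd-corner≢facing
    }

lemma11 : (k ℓ : ℕ) → 1 ≤ k → 1 ≤ ℓ → (H : SimpleGraph) → IsMinor H (Grid k ℓ) →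
    Σ (Model H (Grid (2 * k) (2 * ℓ))) λ M →
    Σ ((v w : Fin (SimpleGraph.n H)) → v < w → SimpleGraph.Edge H v w →
        RepEdge H (Grid (2 * k) (2 * ℓ)) M v w) λ e →
    (u : Fin (SimpleGraph.n H)) →
      Σ (Graph.V (Grid (2 * k) (2 * ℓ))) λ h →
        Model.B M u h ×
        ((v w : Fin (SimpleGraph.n H)) (p : v < w) (q : SimpleGraph.Edge H v w) →
          ¬ (h ≡ RepEdge.a (e v w p q)) × ¬ (h ≡ RepEdge.b (e v w p q)))
lemma11 k ℓ _ _ H M = pullback-with-holes (λ {x} {y} → Grid-sym {x = x} {y}) halving odd-corners M
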